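{- Let $k \geq 2$ and $r \geq 2$ be integers, let $q = \frac{r^k-1}{r-1}$, and let $m$ be a positive integer such that $m^{1/q}$ is an integer. Let $G$ be the complete $k$-partite $k$-uniform hypergraph with parts $U_1, \ldots, U_k$, where $|U_i| = m^{r^{i-1}/q}$ for $1 \leq i \leq k$. Then $G$ has $m$ edges, and every $K^{(k)}_{r,\ldots,r}$-free subhypergraph of $G$ has at most $r\, m^{(q-1)/q}$ edges.
   Context: The complete $k$-partite $k$-uniform hypergraph with parts $U_1,\ldots,U_k$ has as edges all $k$-sets containing exactly one vertex from each $U_i$. $K^{(k)}_{r,\ldots,r}$ denotes the complete $k$-partite $k$-uniform hypergraph with $k$ parts each of size $r$. A hypergraph is $K^{(k)}_{r,\ldots,r}$-free if it contains no subhypergraph isomorphic to $K^{(k)}_{r,\ldots,r}$. -}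

module Defs where

open import Data.Nat using (ℕ; zero; suc; _+_; _*_; _∸_; _^_; _≤_)
open import Data.Nat.DivMod using (_/_)
open import Data.Fin using (Fin; toℕ)
open import Data.List using (List; length)
open import Data.List.Relation.Unary.Any using (Any)
open import Data.List.Relation.Unary.AllPairs using (AllPairs)
open import Data.Product using (Σ; _×_)
open import Function.Definitions using (Injective)
open import Relation.Binary.PropositionalEquality using (_≡_)
open import Relation.Nullary using (¬_)

-- q = (r^k - 1)/(r - 1); only used for r ≥ 2 (value for r < 2 is a dummy 0).
qOf : ℕ → ℕ → ℕ
qOf (suc (suc r')) k = ((suc (suc r')) ^ k ∸ 1) / suc r'
qOf _ k = 0

Edge : (k : ℕ) → (Fin k → ℕ) → Set
Edge k size = (i : Fin k) → Fin (size i)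

_≈E_ : ∀ {k size} → Edge k size → Edge k size → Set
e ≈E e' = ∀ i → e i ≡ e' i

record SubHypergraph (k : ℕ) (size : Fin k → ℕ) : Set where
  field
    edges    : List (Edge k size)
    distinct : AllPairs (λ e e' → ¬ (e ≈E e')) edges

open SubHypergraph public

numEdges : ∀ {k size} → SubHypergraph k size → ℕ
numEdges H = length (edges H)

_∈E_ : ∀ {k size} → Edge k size → SubHypergraph k size → Set
e ∈E H = Any (λ e' → e ≈E e') (edges H)

-- H contains a copy of K^{(k)}_{r,...,r}: r-element sets S_i ⊆ U_i
-- (given by injections Fin r → U_i) such that every edge with one vertex
-- from each S_i lies in H.
ContainsK : ∀ {k size} → ℕ → SubHypergraph k size → Set
ContainsK {k} {size} r H =
  Σ ((i : Fin k) → Fin r → Fin (size i)) λ S →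
    ((i : Fin k) → Injective _≡_ _≡_ (S i)) ×
    ((c : Fin k → Fin r) → (λ i → S i (c i)) ∈E H)

KFree : ∀ {k size} → ℕ → SubHypergraph k size → Set
KFree r H = ¬ ContainsK r H

HasNEdges : (k : ℕ) → (Fin k → ℕ) → ℕ → Set
HasNEdges k size n =
  Σ (Edge k size → Fin n) λ enc →
  Σ (Fin n → Edge k size) λ dec →
    (∀ e → dec (enc e) ≈E e) × (∀ j → enc (dec j) ≡ j)

-- Part sizes |U_i| = t^(r^(i-1)) for i = 1..k (0-indexed here).
partSize : ℕ → ℕ → (k : ℕ) → Fin k → ℕ
partSize t r k i = t ^ (r ^ toℕ i)

-- Kővári–Sós–Turán counting, one part at a time. For a K_r-free H and each edge y
-- of the complete hypergraph on U₂,…,U_k let d(y) be the number of x ∈ U₁ with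
-- x ∪ y ∈ H. Then |H| = Σ_y d(y) ≤ (r−1)|U₂|⋯|U_k| + Σ_y (d(y) − (r−1))⁺, and the
-- excess is at most C(|U₁|, r) times the extremal number for U₂,…,U_k, because the
-- common neighbourhood of any r vertices of U₁ is K_r-free. Since
-- r·C(|U_i|, r) ≤ |U_i|^r = |U_{i+1}|, this recursion telescopes to
-- r|U₂|⋯|U_k| = r·t^(r+⋯+r^(k−1)) = r·t^(q−1), while |U₁|⋯|U_k| = t^q = m.

module Submission where

open import Defs
open import Data.Bool.Base using (Bool; true; false; _∧_; _∨_; T)
open import Data.Bool.Properties using (∧-identityʳ; T-∧)
open import Data.Empty using (⊥-elim)
open import Data.Fin.Base using (Fin; zero; suc; toℕ; combine; remQuot; lift)
import Data.Fin.Properties as Finₚ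
open import Data.List.Base using (List; []; _∷_; length)
open import Data.List.Relation.Unary.All.Properties using (All¬⇒¬Any)
open import Data.List.Relation.Unary.Any as Any using (Any; here; any?)
open import Data.List.Relation.Unary.AllPairs using (AllPairs; []; _∷_)
open import Data.Nat.Base
open import Data.Nat.Combinatorics
  using (_C_; nCk+nC[k+1]≡[n+1]C[k+1]; nC1≡n; k>n⇒nCk≡0)
open import Data.Nat.DivMod using (_/_; m*n/n≡m)
open import Data.Nat.Properties
open import Data.Nat.Tactic.RingSolver using (solve-∀)
open import Algebra.Properties.Semiring.Sum +-*-semiring
  using (sum; sum-syntax; sum-cong-≗; ∑-distrib-+; *-distribˡ-sum)
open import Algebra.Properties.Monoid.Sum *-1-monoid using () renaming (sum to product)
open import Data.Product.Base using (Σ; _×_; _,_; proj₁; proj₂; uncurry)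
open import Data.Unit.Base using (tt)
open import Data.Vec.Functional using (Vector; foldr; tail)
open import Function.Base using (_∘_)
open import Function.Bundles using (mk⇔; Equivalence)
open import Function.Definitions using (Injective)
open import Relation.Binary.Core using (_Preserves_⟶_)
open import Relation.Binary.Definitions using (Decidable)
open import Relation.Binary.PropositionalEquality
open import Relation.Nullary.Decidable
  using (does; dec-true; dec-false; does-⇔; toWitness; isYes≗does)
open import Relation.Nullary.Negation using (¬_)

∑-const : ∀ n c → ∑[ i < n ] c ≡ n * c
∑-const zero    c = refl
∑-const (suc n) c = cong (c +_) (∑-const n c)

∑-mono-≤ : ∀ {n} {f g : Vector ℕ n} → (∀ i → f i ≤ g i) → sum f ≤ sum g
∑-mono-≤ {zero}  f≤g = z≤n
∑-mono-≤ {suc n} f≤g = +-mono-≤ (f≤g zero) (∑-mono-≤ (f≤g ∘ suc))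

∑-mono-< : ∀ {n} {f g : Vector ℕ n} → (∀ i → f i ≤ g i) → ∀ i → f i < g i → sum f < sum g
∑-mono-< f≤g zero    fi<gi = +-mono-<-≤ fi<gi (∑-mono-≤ (f≤g ∘ suc))
∑-mono-< f≤g (suc i) fi<gi = +-mono-≤-< (f≤g zero) (∑-mono-< (f≤g ∘ suc) i fi<gi)

nCk≤n^k : ∀ n k → n C k ≤ n ^ k
nCk≤n^k n       zero    = ≤-refl
nCk≤n^k zero    (suc k) = ≤-reflexive (k>n⇒nCk≡0 {0} {suc k} z<s)
nCk≤n^k (suc n) (suc k) = begin
  suc n C suc k     ≡⟨ nCk+nC[k+1]≡[n+1]C[k+1] n k ⟨
  n C k + n C suc k ≤⟨ +-mono-≤ (nCk≤n^k n k) (nCk≤n^k n (suc k)) ⟩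
  suc n * n ^ k     ≤⟨ *-monoʳ-≤ (suc n) (^-monoˡ-≤ k (n≤1+n n)) ⟩
  suc n * suc n ^ k ∎
  where open ≤-Reasoning

[1+k]*[1+n]C[1+k]≡[1+n]*nCk : ∀ n k → suc k * (suc n C suc k) ≡ suc n * (n C k)
[1+k]*[1+n]C[1+k]≡[1+n]*nCk zero zero = refl
[1+k]*[1+n]C[1+k]≡[1+n]*nCk zero (suc k) = begin
  suc (suc k) * (1 C suc (suc k)) ≡⟨ cong (suc (suc k) *_) (k>n⇒nCk≡0 {1} {suc (suc k)} (s<s z<s)) ⟩
  suc (suc k) * 0                 ≡⟨ *-zeroʳ (suc (suc k)) ⟩
  0                               ≡⟨ cong (_+ 0) (k>n⇒nCk≡0 {0} {suc k} z<s) ⟨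
  1 * (0 C suc k)                 ∎
  where open ≡-Reasoning
[1+k]*[1+n]C[1+k]≡[1+n]*nCk (suc n) zero = begin
  1 * (suc (suc n) C 1) ≡⟨ *-identityˡ _ ⟩
  suc (suc n) C 1       ≡⟨ nC1≡n (suc (suc n)) ⟩
  suc (suc n)           ≡⟨ *-identityʳ (suc (suc n)) ⟨
  suc (suc n) * 1       ∎
  where open ≡-Reasoning
[1+k]*[1+n]C[1+k]≡[1+n]*nCk (suc n) (suc k) = begin
  suc (suc k) * (suc (suc n) C suc (suc k)) ≡⟨ cong (suc (suc k) *_) (nCk+nC[k+1]≡[n+1]C[k+1] (suc n) (suc k)) ⟨
  suc (suc k) * (a + b)                     ≡⟨ *-distribˡ-+ (suc (suc k)) a b ⟩
  (a + suc k * a) + suc (suc k) * b         ≡⟨ +-assoc a (suc k * a) (suc (suc k) * b) ⟩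
  a + (suc k * a + suc (suc k) * b)         ≡⟨ cong₂ (λ x y → a + (x + y)) ([1+k]*[1+n]C[1+k]≡[1+n]*nCk n k) ([1+k]*[1+n]C[1+k]≡[1+n]*nCk n (suc k)) ⟩
  a + (suc n * (n C k) + suc n * (n C suc k)) ≡⟨ cong (a +_) (*-distribˡ-+ (suc n) (n C k) (n C suc k)) ⟨
  a + suc n * (n C k + n C suc k)           ≡⟨ cong (λ x → a + suc n * x) (nCk+nC[k+1]≡[n+1]C[k+1] n k) ⟩
  suc (suc n) * a                           ∎
  where
  open ≡-Reasoning
  a = suc n C suc k
  b = suc n C suc (suc k)

k*nCk≤n^k : ∀ n k → k * (n C k) ≤ n ^ k
k*nCk≤n^k n       zero    = z≤n
k*nCk≤n^k zero    (suc k) = ≤-reflexive (trans (cong (suc k *_) (k>n⇒nCk≡0 {0} {suc k} z<s)) (*-zeroʳ (suc k)))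
k*nCk≤n^k (suc n) (suc k) = begin
  suc k * (suc n C suc k) ≡⟨ [1+k]*[1+n]C[1+k]≡[1+n]*nCk n k ⟩
  suc n * (n C k)         ≤⟨ *-monoʳ-≤ (suc n) (≤-trans (nCk≤n^k n k) (^-monoˡ-≤ k (n≤1+n n))) ⟩
  suc n * suc n ^ k       ∎
  where open ≤-Reasoning

_∷ᴱ_ : ∀ {k size} → Fin (size zero) → Edge k (tail size) → Edge (suc k) size
_∷ᴱ_ {size = size} = Finₚ.∀-cons {P = Fin ∘ size}

∷ᴱ-congʳ : ∀ {k size} (x : Fin (size zero)) {y y′ : Edge k (tail size)} →
           y ≈E y′ → _≈E_ {suc k} {size} (x ∷ᴱ y) (x ∷ᴱ y′)
∷ᴱ-congʳ x y≈y′ zero    = refl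
∷ᴱ-congʳ x y≈y′ (suc i) = y≈y′ i

∷ᴱ-η : ∀ {k size} (e : Edge (suc k) size) → (e zero ∷ᴱ (e ∘ suc)) ≈E e
∷ᴱ-η e zero    = refl
∷ᴱ-η e (suc i) = refl

-- The first coordinate is summed innermost, so that a sum over the edges of the
-- k+1 parts is literally a sum over the edges y of the last k parts of the
-- degrees of y into the first part.
∑ᴱ : ∀ {k size} → (Edge k size → ℕ) → ℕ
∑ᴱ {zero}          f = f (λ ())
∑ᴱ {suc k} {size} f = ∑ᴱ {k} {tail size} (λ y → ∑[ x < size zero ] f (x ∷ᴱ y))

∑ᴱ-cong : ∀ {k size} {f g : Edge k size → ℕ} → (∀ e → f e ≡ g e) → ∑ᴱ f ≡ ∑ᴱ g
∑ᴱ-cong {zero}  f≗g = f≗g _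
∑ᴱ-cong {suc k} f≗g = ∑ᴱ-cong {k} (λ y → sum-cong-≗ (λ x → f≗g (x ∷ᴱ y)))

∑ᴱ-mono-≤ : ∀ {k size} {f g : Edge k size → ℕ} → (∀ e → f e ≤ g e) → ∑ᴱ f ≤ ∑ᴱ g
∑ᴱ-mono-≤ {zero}  f≤g = f≤g _
∑ᴱ-mono-≤ {suc k} f≤g = ∑ᴱ-mono-≤ {k} (λ y → ∑-mono-≤ (λ x → f≤g (x ∷ᴱ y)))

∑ᴱ-distrib-+ : ∀ {k size} (f g : Edge k size → ℕ) → ∑ᴱ (λ e → f e + g e) ≡ ∑ᴱ f + ∑ᴱ g
∑ᴱ-distrib-+ {zero}  f g = refl
∑ᴱ-distrib-+ {suc k} f g =
  trans (∑ᴱ-cong {k} (λ y → ∑-distrib-+ (λ x → f (x ∷ᴱ y)) (λ x → g (x ∷ᴱ y))))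
        (∑ᴱ-distrib-+ {k} _ _)

∑ᴱ-const : ∀ {k size} c → ∑ᴱ {k} {size} (λ _ → c) ≡ c * product size
∑ᴱ-const {zero}          c = sym (*-identityʳ c)
∑ᴱ-const {suc k} {size} c = begin
  ∑ᴱ {k} {tail size} (λ _ → ∑[ x < size zero ] c) ≡⟨ ∑ᴱ-cong {k} {tail size} (λ _ → ∑-const (size zero) c) ⟩
  ∑ᴱ {k} {tail size} (λ _ → size zero * c)        ≡⟨ ∑ᴱ-const {k} {tail size} (size zero * c) ⟩
  size zero * c * p               ≡⟨ cong (_* p) (*-comm (size zero) c) ⟩
  c * size zero * p               ≡⟨ *-assoc c (size zero) p ⟩
  c * (size zero * p)             ∎
  where
  open ≡-Reasoning
  p = product (tail size)

∑ᴱ-mono-< : ∀ {k size} {f g : Edge k size → ℕ} →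
            f Preserves _≈E_ ⟶ _≡_ → g Preserves _≈E_ ⟶ _≡_ →
            (∀ e → f e ≤ g e) → ∀ e → f e < g e → ∑ᴱ f < ∑ᴱ g
∑ᴱ-mono-< {zero} f-pres g-pres f≤g e fe<ge =
  subst₂ _<_ (f-pres (λ ())) (g-pres (λ ())) fe<ge
∑ᴱ-mono-< {suc k} f-pres g-pres f≤g e fe<ge =
  ∑ᴱ-mono-< {k}
    (λ y≈y′ → sum-cong-≗ (λ x → f-pres (∷ᴱ-congʳ x y≈y′)))
    (λ y≈y′ → sum-cong-≗ (λ x → g-pres (∷ᴱ-congʳ x y≈y′)))
    (λ y → ∑-mono-≤ (λ x → f≤g (x ∷ᴱ y)))
    (e ∘ suc)
    (∑-mono-< (λ x → f≤g _) (e zero) (subst₂ _<_ (f-pres e≈) (g-pres e≈) fe<ge))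
  where
  e≈ : e ≈E (e zero ∷ᴱ (e ∘ suc))
  e≈ i = sym (∷ᴱ-η e i)

𝟙 : Bool → ℕ
𝟙 false = 0
𝟙 true  = 1

¬T⇒𝟙≡0 : ∀ {b} → ¬ T b → 𝟙 b ≡ 0
¬T⇒𝟙≡0 {false} _  = refl
¬T⇒𝟙≡0 {true}  ¬T = ⊥-elim (¬T tt)

𝟙-∨ʳ : ∀ a b → 𝟙 b ≤ 𝟙 (a ∨ b)
𝟙-∨ʳ true  false = z≤n
𝟙-∨ʳ true  true  = ≤-refl
𝟙-∨ʳ false b     = ≤-refl

count : ∀ {k size} → (Edge k size → Bool) → ℕ
count p = ∑ᴱ (𝟙 ∘ p)

count-cong : ∀ {k size} {p q : Edge k size → Bool} → (∀ e → p e ≡ q e) → count p ≡ count q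
count-cong p≗q = ∑ᴱ-cong (cong 𝟙 ∘ p≗q)

degree : ∀ {t} {A : Set} → (Fin t → A → Bool) → A → ℕ
degree {t} b y = ∑[ x < t ] 𝟙 (b x y)

degree∸suc≤ : ∀ {t} {A : Set} j (b : Fin (suc t) → A → Bool) y →
              degree b y ∸ suc j ≤
              (degree (λ x → b (suc x)) y ∸ suc j) + (degree (λ x z → b zero z ∧ b (suc x) z) y ∸ j)
degree∸suc≤ j b y with b zero y
... | false = m≤m+n _ _
... | true  = m≤n+m _ _

⋀ : ∀ {n} → Vector Bool n → Bool
⋀ = foldr _∧_ true

⋀-cong : ∀ {n} {bs cs : Vector Bool n} → (∀ i → bs i ≡ cs i) → ⋀ bs ≡ ⋀ cs
⋀-cong {zero}  bs≗cs = refl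
⋀-cong {suc n} bs≗cs = cong₂ _∧_ (bs≗cs zero) (⋀-cong (λ i → bs≗cs (suc i)))

∧-distrib-⋀ : ∀ {n} a (bs : Vector Bool (suc n)) → ⋀ (λ i → a ∧ bs i) ≡ a ∧ ⋀ bs
∧-distrib-⋀ true  bs = refl
∧-distrib-⋀ false bs = refl

T-⋀ : ∀ {n} (bs : Vector Bool n) → T (⋀ bs) → ∀ i → T (bs i)
T-⋀ bs all-bs zero    = proj₁ (Equivalence.to T-∧ all-bs)
T-⋀ bs all-bs (suc i) = T-⋀ (tail bs) (proj₂ (Equivalence.to T-∧ all-bs)) i

-- Summing (d − j)⁺ ≤ C(d, j+1) over y would need a sum over (j+1)-subsets of rows;
-- a Pascal induction on the number t of rows avoids it.
∑ᴱ-degree∸≤ : ∀ {k size t} (F : ℕ) j (b : Fin t → Edge k size → Bool) →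
              (∀ (X : Fin (suc j) → Fin t) → Injective _≡_ _≡_ X →
                 count (λ y → ⋀ (λ a → b (X a) y)) ≤ F) →
              ∑ᴱ (λ y → degree b y ∸ j) ≤ (t C suc j) * F
∑ᴱ-degree∸≤ {k} {size} {zero} F j b _ =
  ≤-trans (≤-reflexive (trans (∑ᴱ-cong {k} {size} (λ _ → 0∸n≡0 j)) (∑ᴱ-const {k} {size} 0))) z≤n
∑ᴱ-degree∸≤ {k} {size} {suc t} F zero b common≤F = begin
  ∑ᴱ (λ y → 𝟙 (b zero y) + degree (λ x → b (suc x)) y)       ≡⟨ ∑ᴱ-distrib-+ (𝟙 ∘ b zero) (degree (λ x → b (suc x))) ⟩
  count (b zero) + ∑ᴱ (λ y → degree (λ x → b (suc x)) y ∸ 0) ≤⟨ +-mono-≤ row₀≤F rows≤ ⟩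
  F + (t C 1) * F                                              ≡⟨ cong (_* F) (nCk+nC[k+1]≡[n+1]C[k+1] t 0) ⟩
  (suc t C 1) * F                                              ∎
  where
  open ≤-Reasoning
  row₀≤F : count (b zero) ≤ F
  row₀≤F = ≤-trans (≤-reflexive (count-cong (λ y → sym (∧-identityʳ (b zero y)))))
                   (common≤F (λ _ → zero) (λ { {zero} {zero} _ → refl }))
  rows≤ : ∑ᴱ (λ y → degree (λ x → b (suc x)) y ∸ 0) ≤ (t C 1) * F
  rows≤ = ∑ᴱ-degree∸≤ F 0 (λ x → b (suc x))
            (λ X X-inj → common≤F (λ a → suc (X a)) (λ eq → X-inj (Finₚ.suc-injective eq)))
∑ᴱ-degree∸≤ {k} {size} {suc t} F (suc j) b common≤F = begin
  ∑ᴱ (λ y → degree b y ∸ suc j)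
    ≤⟨ ∑ᴱ-mono-≤ (degree∸suc≤ j b) ⟩
  ∑ᴱ (λ y → (degree tail-rows y ∸ suc j) + (degree meet-rows y ∸ j))
    ≡⟨ ∑ᴱ-distrib-+ (λ y → degree tail-rows y ∸ suc j) (λ y → degree meet-rows y ∸ j) ⟩
  ∑ᴱ (λ y → degree tail-rows y ∸ suc j) + ∑ᴱ (λ y → degree meet-rows y ∸ j)
    ≤⟨ +-mono-≤ (∑ᴱ-degree∸≤ F (suc j) tail-rows tail-common≤F)
                (∑ᴱ-degree∸≤ F j meet-rows meet-common≤F) ⟩
  (t C suc (suc j)) * F + (t C suc j) * F
    ≡⟨ *-distribʳ-+ F (t C suc (suc j)) (t C suc j) ⟨
  (t C suc (suc j) + t C suc j) * F
    ≡⟨ cong (_* F) (trans (+-comm (t C suc (suc j)) (t C suc j)) (nCk+nC[k+1]≡[n+1]C[k+1] t (suc j))) ⟩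
  (suc t C suc (suc j)) * F
    ∎
  where
  open ≤-Reasoning
  tail-rows meet-rows : Fin t → Edge k size → Bool
  tail-rows x y = b (suc x) y
  meet-rows x y = b zero y ∧ b (suc x) y
  tail-common≤F : ∀ (X : Fin (suc (suc j)) → Fin t) → Injective _≡_ _≡_ X →
                  count (λ y → ⋀ (λ a → tail-rows (X a) y)) ≤ F
  tail-common≤F X X-inj = common≤F (λ a → suc (X a)) (λ eq → X-inj (Finₚ.suc-injective eq))
  meet-common≤F : ∀ (X : Fin (suc j) → Fin t) → Injective _≡_ _≡_ X →
                  count (λ y → ⋀ (λ a → meet-rows (X a) y)) ≤ F
  meet-common≤F X X-inj =
    ≤-trans (≤-reflexive (count-cong (λ y → ∧-distrib-⋀ (b zero y) (λ a → b (suc (X a)) y))))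
            (common≤F (lift 1 X) (Finₚ.lift-injective X X-inj 1))

box : ∀ {k size r} → ((i : Fin k) → Fin r → Fin (size i)) → (Fin k → Fin r) → Edge k size
box S c i = S i (c i)

ContainsKᵇ : ∀ {k size} → ℕ → (Edge k size → Bool) → Set
ContainsKᵇ {k} {size} r p =
  Σ ((i : Fin k) → Fin r → Fin (size i)) λ S →
    ((i : Fin k) → Injective _≡_ _≡_ (S i)) × ((c : Fin k → Fin r) → T (p (box S c)))

ContainsKᵇ-∷ : ∀ {r k size} (p : Edge (suc k) size → Bool) → p Preserves _≈E_ ⟶ _≡_ →
               (X : Fin r → Fin (size zero)) → Injective _≡_ _≡_ X →
               ContainsKᵇ r (λ y → ⋀ (λ a → p (X a ∷ᴱ y))) → ContainsKᵇ r p
ContainsKᵇ-∷ {r} {k} {size} p p-pres X X-inj (S , S-inj , S-full) = S′ , S′-inj , S′-full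
  where
  S′ : (i : Fin (suc k)) → Fin r → Fin (size i)
  S′ zero    = X
  S′ (suc i) = S i
  S′-inj : (i : Fin (suc k)) → Injective _≡_ _≡_ (S′ i)
  S′-inj zero    = X-inj
  S′-inj (suc i) = S-inj i
  box-∷ : (c : Fin (suc k) → Fin r) → (X (c zero) ∷ᴱ box S (tail c)) ≈E box S′ c
  box-∷ c zero    = refl
  box-∷ c (suc i) = refl
  S′-full : (c : Fin (suc k) → Fin r) → T (p (box S′ c))
  S′-full c = subst T (p-pres (box-∷ c)) (T-⋀ _ (S-full (tail c)) (c zero))

zBound : ℕ → (k : ℕ) → Vector ℕ k → ℕ
zBound r zero    size = 0
zBound r (suc k) size = (r ∸ 1) * product (tail size) + (size zero C r) * zBound r k (tail size)

count≤zBound : ∀ {j k size} (p : Edge k size → Bool) → p Preserves _≈E_ ⟶ _≡_ →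
               ¬ ContainsKᵇ (suc j) p → count p ≤ zBound (suc j) k size
count≤zBound {k = zero} p p-pres K-free =
  ≤-reflexive (¬T⇒𝟙≡0 (λ p[] → K-free ((λ ()) , (λ ()) , λ c → subst T (p-pres (λ ())) p[])))
count≤zBound {j} {suc k} {size} p p-pres K-free = begin
  ∑ᴱ (degree rows)                                        ≤⟨ ∑ᴱ-mono-≤ (λ y → m≤n+m∸n (degree rows y) j) ⟩
  ∑ᴱ (λ y → j + (degree rows y ∸ j))                      ≡⟨ ∑ᴱ-distrib-+ (λ _ → j) (λ y → degree rows y ∸ j) ⟩
  ∑ᴱ {k} {tail size} (λ _ → j) + ∑ᴱ (λ y → degree rows y ∸ j)
    ≤⟨ +-mono-≤ (≤-reflexive (∑ᴱ-const {k} {tail size} j)) (∑ᴱ-degree∸≤ _ j rows common≤zBound) ⟩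
  j * product (tail size) + (size zero C suc j) * zBound (suc j) k (tail size) ∎
  where
  open ≤-Reasoning
  rows : Fin (size zero) → Edge k (tail size) → Bool
  rows x y = p (x ∷ᴱ y)
  common≤zBound : ∀ (X : Fin (suc j) → Fin (size zero)) → Injective _≡_ _≡_ X →
                  count (λ y → ⋀ (λ a → rows (X a) y)) ≤ zBound (suc j) k (tail size)
  common≤zBound X X-inj = count≤zBound _
    (λ y≈y′ → ⋀-cong (λ a → p-pres (∷ᴱ-congʳ (X a) y≈y′)))
    (K-free ∘ ContainsKᵇ-∷ p p-pres X X-inj)

_≈E?_ : ∀ {k size} → Decidable (_≈E_ {k} {size})
e ≈E? e′ = Finₚ.all? (λ i → e i Finₚ.≟ e′ i)

member : ∀ {k size} → List (Edge k size) → Edge k size → Bool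
member L e = does (any? (e ≈E?_) L)

member-preserves : ∀ {k size} (L : List (Edge k size)) → member L Preserves _≈E_ ⟶ _≡_
member-preserves L e≈e′ = does-⇔
  (mk⇔ (Any.map (λ e≈x i → trans (sym (e≈e′ i)) (e≈x i)))
       (Any.map (λ e′≈x i → trans (e≈e′ i) (e′≈x i))))
  (any? _ L) (any? _ L)

member-sound : ∀ {k size} (L : List (Edge k size)) e → T (member L e) → Any (e ≈E_) L
member-sound L e e∈L = toWitness (subst T (sym (isYes≗does (any? (e ≈E?_) L))) e∈L)

length≤count-member : ∀ {k size} (L : List (Edge k size)) →
                      AllPairs (λ e e′ → ¬ e ≈E e′) L → length L ≤ count (member L)
length≤count-member []      []                   = z≤n
length≤count-member (e ∷ L) (e∉L ∷ L-distinct) = begin-strict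
  length L               ≤⟨ length≤count-member L L-distinct ⟩
  count (member L)       <⟨ ∑ᴱ-mono-< (cong 𝟙 ∘ member-preserves L) (cong 𝟙 ∘ member-preserves (e ∷ L))
                                      (λ x → 𝟙-∨ʳ (does (x ≈E? e)) (member L x)) e new ⟩
  count (member (e ∷ L)) ∎
  where
  open ≤-Reasoning
  new : 𝟙 (member L e) < 𝟙 (member (e ∷ L) e)
  new = subst₂ (λ a b → 𝟙 a < 𝟙 b)
          (sym (dec-false (any? (e ≈E?_) L) (All¬⇒¬Any e∉L)))
          (sym (dec-true (any? (e ≈E?_) (e ∷ L)) (here (λ _ → refl))))
          ≤-refl

KFree⇒¬ContainsKᵇ : ∀ {k size r} (H : SubHypergraph k size) → KFree r H → ¬ ContainsKᵇ r (member (edges H))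
KFree⇒¬ContainsKᵇ H K-free (S , S-inj , S-full) =
  K-free (S , S-inj , λ c → member-sound (edges H) (box S c) (S-full c))

numEdges≤zBound : ∀ {j k size} (H : SubHypergraph k size) → KFree (suc j) H →
                  numEdges H ≤ zBound (suc j) k size
numEdges≤zBound H K-free =
  ≤-trans (length≤count-member (edges H) (distinct H))
          (count≤zBound _ (member-preserves (edges H)) (KFree⇒¬ContainsKᵇ H K-free))

encode : ∀ {k size} → Edge k size → Fin (product size)
encode {zero}          e = zero
encode {suc k} {size} e = combine (e zero) (encode {k} {tail size} (λ i → e (suc i)))

decode : ∀ {k size} → Fin (product size) → Edge k size
decode {zero}          j ()
decode {suc k} {size} j = uncurry cons (remQuot {size zero} (product (tail size)) j)
  where
  cons : Fin (size zero) → Fin (product (tail size)) → Edge (suc k) size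
  cons x y = x ∷ᴱ decode y

decode-combine : ∀ {k size} (x : Fin (size zero)) (y : Fin (product (tail size))) →
                 decode {suc k} {size} (combine x y) ≈E (x ∷ᴱ decode y)
decode-combine {k} {size} x y i =
  cong (λ xy → _∷ᴱ_ {size = size} (proj₁ xy) (decode (proj₂ xy)) i)
       (Finₚ.remQuot-combine {size zero} {product (tail size)} x y)

decode-encode : ∀ {k size} (e : Edge k size) → decode (encode e) ≈E e
decode-encode {zero}          e ()
decode-encode {suc k} {size} e i = begin
  decode (encode e) i                            ≡⟨ decode-combine (e zero) (encode e₊) i ⟩
  (e zero ∷ᴱ decode (encode e₊)) i               ≡⟨ ∷ᴱ-congʳ (e zero) (decode-encode e₊) i ⟩
  (e zero ∷ᴱ e₊) i                               ≡⟨ ∷ᴱ-η e i ⟩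
  e i                                            ∎
  where
  open ≡-Reasoning
  e₊ : Edge k (tail size)
  e₊ i = e (suc i)

encode-decode : ∀ {k size} (j : Fin (product size)) → encode {k} {size} (decode j) ≡ j
encode-decode {zero}          zero = refl
encode-decode {suc k} {size} j =
  trans (cong (combine (proj₁ xy)) (encode-decode {k} {tail size} (proj₂ xy)))
        (Finₚ.combine-remQuot {size zero} (product (tail size)) j)
  where xy = remQuot {size zero} (product (tail size)) j

hasNEdges : ∀ {k} (size : Vector ℕ k) → HasNEdges k size (product size)
hasNEdges size = encode , decode , decode-encode , encode-decode {size = size}

zBound≤ : ∀ j k (n : ℕ → ℕ) → (∀ i → suc j * (n i C suc j) ≤ n (suc i)) →
          zBound (suc j) (suc k) (n ∘ toℕ) ≤ suc j * product (λ (i : Fin k) → n (suc (toℕ i)))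
zBound≤ j zero n grows = begin
  j * 1 + (n 0 C suc j) * 0 ≡⟨ cong₂ _+_ (*-identityʳ j) (*-zeroʳ (n 0 C suc j)) ⟩
  j + 0                     ≡⟨ +-identityʳ j ⟩
  j                         ≤⟨ n≤1+n j ⟩
  suc j                     ≡⟨ *-identityʳ (suc j) ⟨
  suc j * 1                 ∎
  where open ≤-Reasoning
zBound≤ j (suc k) n grows = begin
  j * P + (n 0 C suc j) * zBound (suc j) (suc k) (λ i → n (suc (toℕ i)))
    ≤⟨ +-monoʳ-≤ (j * P) (*-monoʳ-≤ (n 0 C suc j) (zBound≤ j k (λ i → n (suc i)) (λ i → grows (suc i)))) ⟩
  j * P + (n 0 C suc j) * (suc j * P′)
    ≡⟨ cong (j * P +_) (trans (sym (*-assoc (n 0 C suc j) (suc j) P′)) (cong (_* P′) (*-comm (n 0 C suc j) (suc j)))) ⟩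
  j * P + suc j * (n 0 C suc j) * P′
    ≤⟨ +-monoʳ-≤ (j * P) (*-monoˡ-≤ P′ (grows 0)) ⟩
  j * P + P
    ≡⟨ +-comm (j * P) P ⟩
  suc j * P
    ∎
  where
  open ≤-Reasoning
  P  = product (λ (i : Fin (suc k)) → n (suc (toℕ i)))
  P′ = product (λ (i : Fin k) → n (suc (suc (toℕ i))))

product-^ : ∀ {n} T (f : Vector ℕ n) → product (λ i → T ^ f i) ≡ T ^ sum f
product-^ {zero}  T f = refl
product-^ {suc n} T f = begin
  T ^ f zero * product (λ i → T ^ f (suc i)) ≡⟨ cong (T ^ f zero *_) (product-^ T (f ∘ suc)) ⟩
  T ^ f zero * T ^ sum (f ∘ suc)             ≡⟨ ^-distribˡ-+-* T (f zero) (sum (f ∘ suc)) ⟨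
  T ^ sum f                                  ∎
  where open ≡-Reasoning

geometric : ∀ r k → suc ((∑[ i < k ] (suc r ^ toℕ i)) * r) ≡ suc r ^ k
geometric r zero    = refl
geometric r (suc k) = begin
  suc ((1 + ∑[ i < k ] (suc r * suc r ^ toℕ i)) * r) ≡⟨ cong (λ s → suc ((1 + s) * r)) (*-distribˡ-sum {k} (suc r) (λ i → suc r ^ toℕ i)) ⟨
  suc ((1 + suc r * s) * r)                           ≡⟨ shift r s ⟩
  suc r * suc (s * r)                                 ≡⟨ cong (suc r *_) (geometric r k) ⟩
  suc r * suc r ^ k                                   ∎
  where
  open ≡-Reasoning
  s = ∑[ i < k ] (suc r ^ toℕ i)
  shift : ∀ r s → suc ((1 + suc r * s) * r) ≡ suc r * suc (s * r)
  shift = solve-∀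

qOf≡∑r^i : ∀ j k → qOf (suc (suc j)) k ≡ ∑[ i < k ] (suc (suc j) ^ toℕ i)
qOf≡∑r^i j k = begin
  (suc (suc j) ^ k ∸ 1) / suc j ≡⟨ cong (λ x → (x ∸ 1) / suc j) (geometric (suc j) k) ⟨
  (s * suc j) / suc j           ≡⟨ m*n/n≡m s (suc j) ⟩
  s                             ∎
  where
  open ≡-Reasoning
  s = ∑[ i < k ] (suc (suc j) ^ toℕ i)

t^r^i-grows : ∀ t r i → r * (t ^ (r ^ i) C r) ≤ t ^ (r ^ suc i)
t^r^i-grows t r i = begin
  r * (t ^ (r ^ i) C r) ≤⟨ k*nCk≤n^k (t ^ (r ^ i)) r ⟩
  (t ^ (r ^ i)) ^ r     ≡⟨ ^-*-assoc t (r ^ i) r ⟩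
  t ^ (r ^ i * r)       ≡⟨ cong (t ^_) (*-comm (r ^ i) r) ⟩
  t ^ (r ^ suc i)       ∎
  where open ≤-Reasoning

theorem4 : (k r m t : ℕ) → 2 ≤ k → 2 ≤ r → 1 ≤ m → t ^ qOf r k ≡ m →
    HasNEdges k (partSize t r k) m ×
    ((H : SubHypergraph k (partSize t r k)) → KFree r H →
      numEdges H ≤ r * t ^ (qOf r k ∸ 1))
theorem4 zero    _             _ _ ()  _        _ _
theorem4 (suc k) zero          _ _ _   ()       _ _
theorem4 (suc k) (suc zero)    _ _ _   (s≤s ()) _ _
theorem4 (suc k) r@(suc (suc j)) m t _ _ _ t^q≡m =
  subst (HasNEdges (suc k) (partSize t r (suc k))) product≡m (hasNEdges (partSize t r (suc k))) ,
  λ H K-free → begin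
    numEdges H                                            ≤⟨ numEdges≤zBound H K-free ⟩
    zBound r (suc k) (partSize t r (suc k))               ≤⟨ zBound≤ (suc j) k (λ i → t ^ (r ^ i)) (t^r^i-grows t r) ⟩
    r * product (λ (i : Fin k) → t ^ (r ^ suc (toℕ i)))   ≡⟨ cong (r *_) (product-^ t (λ (i : Fin k) → r ^ suc (toℕ i))) ⟩
    r * t ^ (∑[ i < suc k ] (r ^ toℕ i) ∸ 1)               ≡⟨ cong (λ q → r * t ^ (q ∸ 1)) (qOf≡∑r^i j (suc k)) ⟨
    r * t ^ (qOf r (suc k) ∸ 1)                           ∎
  where
  open ≤-Reasoning
  product≡m : product (partSize t r (suc k)) ≡ m
  product≡m = begin-equality
    product (partSize t r (suc k))          ≡⟨ product-^ t (λ (i : Fin (suc k)) → r ^ toℕ i) ⟩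
    t ^ (∑[ i < suc k ] (r ^ toℕ i))        ≡⟨ cong (t ^_) (qOf≡∑r^i j (suc k)) ⟨
    t ^ qOf r (suc k)                       ≡⟨ t^q≡m ⟩
    m                                       ∎
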